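{- For every $\lambda$-term $t$ and every repetition-free list $\vec x = (x_1,\dots,x_k)$ of variables with $\mathrm{fv}(t)\subseteq\{x_1,\dots,x_k\}$, one has $[\![ t^{n} ]\!]_{\vec x} = [\![ t ]\!]^{n}_{\vec x}$ up to Seely's isomorphisms, i.e. $[\![ t^{n} ]\!]_{\vec x} = [\![ t ]\!]^{n}_{\vec x} \circ \phi_k$ where $\phi_k \colon (!\mathcal{U})^{\otimes k} \to {!(\mathcal{U}^{k})}$ is the canonical isomorphism built from the Seely isomorphisms $\mathsf{m}^0,\mathsf{m}^2$ (here $\mathcal{U}^k = \mathcal{U}\,\&\cdots\&\,\mathcal{U}$, $k$ times).
   Context: Let $\mathcal{L}$ be a $*$-autonomous category (symmetric monoidal closed with tensor $\otimes$, unit $1$, linear implication $X\multimap Y$, evaluation $\mathrm{ev}\in\mathcal{L}((X\multimap Y)\otimes X, Y)$, linear currying $\mathrm{cur}\colon\mathcal{L}(Z\otimes X,Y)\to\mathcal{L}(Z,X\multimap Y)$, and a dualizing object), which is cartesian with terminal object $\top$, binary product $\&$, projections $\pi_1,\pi_2$ and pairing $\langle f,g\rangle$ (hence cocartesian with initial object $0$). It is equipped with a functor $!$ which is a comonad (counit/dereliction $\mathrm{der}_X\colon !X\to X$, comultiplication/digging $\mathrm{dig}_X\colon !X \to !!X$) and a strong symmetric monoidal functor from $(\mathcal{L},\&,\top)$ to $(\mathcal{L},\otimes,1)$ with Seely isos $\mathsf{m}^0\in\mathcal{L}(1,!\top)$, $\mathsf{m}^2_{X,Y}\in\mathcal{L}(!X\otimes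 !Y, !(X\& Y))$, coherent with digging (a denotational model of linear logic); it yields weakening $\mathsf{w}_X\colon !X\to 1$, contraction, and for each $k$ a coalgebra structure $\mathsf{p}\colon (!\mathcal{U})^{\otimes k}\to !((!\mathcal{U})^{\otimes k})$ and contraction $\mathsf{c}\colon (!\mathcal{U})^{\otimes k} \to (!\mathcal{U})^{\otimes k}\otimes(!\mathcal{U})^{\otimes k}$. Assume $0=\top$; then for all $X,Y$ let $0_{X,Y}\colon X\to\top = 0\to Y$ be the zero morphism. Let $\mathcal{U}$ be an object with $\mathcal{U} = {!\mathcal{U}}\,\&\,({!\mathcal{U}}\multimap\mathcal{U})$. Bang calculus terms: $T ::= x \mid \lambda x\,T \mid T\,S \mid \mathrm{der}\,T \mid {!T}$. For $\vec x=(x_1,\dots,x_k)$ repetition-free containing $\mathrm{fv}(T)$, $[\![T]\!]_{\vec x}\in\mathcal{L}((!\mathcal{U})^{\otimes k},\mathcal{U})$ is defined by: $[\![x_i]\!]_{\vec x} = \mathsf{w}_{\mathcal{U}}^{\otimes i-1}\otimes \mathrm{der}_{\mathcal{U}}\otimes \mathsf{w}_{\mathcal{U}}^{\otimes k-i}$ (up to unit isos); $[\![\lambda y\,S]\!]_{\vec x} = \langle 0_{(!\mathcal{U})^{\otimes k}, !\mathcal{U}}, \mathrm{cur}([\![S]\!]_{\vec x,y})\rangle$ ($y$ not in $\vec x$); $[\![S\,R]\!]_{\vec x} = \mathrm{ev}\circ((\pi_2\circ[\![S]\!]_{\vec x})\otimes(\pi_1\circ[\![R]\!]_{\vec x}))\circ\mathsf{c}$;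 $[\![{!S}]\!]_{\vec x} = \langle !([\![S]\!]_{\vec x})\circ \mathsf{p}, 0_{(!\mathcal{U})^{\otimes k}, !\mathcal{U}\multimap\mathcal{U}}\rangle$; $[\![\mathrm{der}\,S]\!]_{\vec x} = \mathrm{der}_{\mathcal{U}}\circ\pi_1\circ[\![S]\!]_{\vec x}$. Kleisli category $\mathcal{L}_!$: $\mathcal{L}_!(A,B) = \mathcal{L}(!A,B)$, composition $f\circ_! g = f\circ !g\circ\mathrm{dig}$, identity $\mathrm{der}_A$; it is cartesian closed with product $\&$, projections $\pi_i\circ\mathrm{der}$ (the $i$-th of $k$ projections from $\mathcal{U}^k$ written $\pi^k_i$), exponential $!A\multimap B$, $\mathrm{Ev} = \mathrm{ev}\circ(\mathrm{der}_{!A\multimap B}\otimes\mathrm{id}_{!A})\circ(\mathsf{m}^2)^{ -1}$ and $\mathrm{Cur}(f) = \mathrm{cur}(f\circ\mathsf{m}^2)$. Let $\lambda = \langle 0_{!\mathcal{U}\multimap\mathcal{U}, !\mathcal{U}}, \mathrm{id}\rangle\colon (!\mathcal{U}\multimap\mathcal{U})\to\mathcal{U}$, $\mathrm{app}=\pi_2\colon\mathcal{U}\to(!\mathcal{U}\multimap\mathcal{U})$, $\mathrm{app}_n = \mathrm{der}\circ !\mathrm{app}$, $\lambda_n = \mathrm{der}\circ !\lambda$. The CbN interpretation of a $\lambda$-term, $[\![t]\!]^{n}_{\vec x}\in\mathcal{L}_!(\mathcal{U}^k,\mathcal{U})$: $[\![x_i]\!]^{n}_{\vec x} = \pi^k_i$;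 $[\![\lambda y\,t]\!]^{n}_{\vec x} = \lambda_n\circ_!\mathrm{Cur}([\![t]\!]^{n}_{\vec x,y})$; $[\![t\,s]\!]^{n}_{\vec x} = \mathrm{Ev}\circ_!\langle \mathrm{app}_n\circ_![\![t]\!]^{n}_{\vec x}, [\![s]\!]^{n}_{\vec x}\rangle$. CbN translation: $x^{n} = x$, $(\lambda x\,t)^{n} = \lambda x\,t^{n}$, $(t\,s)^{n} = t^{n}\,{!(s^{n})}$. -}

module Defs where

open import Level using (Level; _⊔_; suc)
open import Data.Nat using (ℕ; zero) renaming (suc to 1+)
open import Relation.Binary using (Rel; IsEquivalence)
open import Relation.Binary.PropositionalEquality using (_≡_; subst)


record LLModel (o ℓ e : Level) : Set (suc (o ⊔ ℓ ⊔ e)) where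
  infixr 9 _∘_
  infixr 10 _⊗₁_
  infixr 10 _⊗₀_
  infixr 11 _&_
  infixr 8 _⊸_
  infix  4 _≈_
  field
    Ob   : Set o
    Hom  : Ob → Ob → Set ℓ
    _≈_  : ∀ {A B} → Rel (Hom A B) e
    ≈-equiv : ∀ {A B} → IsEquivalence (_≈_ {A} {B})
    id   : ∀ {A} → Hom A A
    _∘_  : ∀ {A B C} → Hom B C → Hom A B → Hom A C
    assoc : ∀ {A B C D} {f : Hom A B} {g : Hom B C} {h : Hom C D} →
            (h ∘ g) ∘ f ≈ h ∘ (g ∘ f)
    identityˡ : ∀ {A B} {f : Hom A B} → id ∘ f ≈ f
    identityʳ : ∀ {A B} {f : Hom A B} → f ∘ id ≈ f
    ∘-resp-≈ : ∀ {A B C} {f h : Hom B C} {g i : Hom A B} →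
               f ≈ h → g ≈ i → f ∘ g ≈ h ∘ i

    _⊗₀_ : Ob → Ob → Ob
    _⊗₁_ : ∀ {A B C D} → Hom A B → Hom C D → Hom (A ⊗₀ C) (B ⊗₀ D)
    ⊗-id : ∀ {A B} → id {A} ⊗₁ id {B} ≈ id
    ⊗-∘  : ∀ {A B C D E F} {f : Hom B C} {g : Hom A B} {h : Hom E F} {k : Hom D E} →
           (f ∘ g) ⊗₁ (h ∘ k) ≈ (f ⊗₁ h) ∘ (g ⊗₁ k)
    ⊗-resp-≈ : ∀ {A B C D} {f f' : Hom A B} {g g' : Hom C D} →
               f ≈ f' → g ≈ g' → f ⊗₁ g ≈ f' ⊗₁ g'
    𝟙 : Ob
    λ⇒ : ∀ {A} → Hom (𝟙 ⊗₀ A) A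
    λ⇐ : ∀ {A} → Hom A (𝟙 ⊗₀ A)
    ρ⇒ : ∀ {A} → Hom (A ⊗₀ 𝟙) A
    ρ⇐ : ∀ {A} → Hom A (A ⊗₀ 𝟙)
    α⇒ : ∀ {A B C} → Hom ((A ⊗₀ B) ⊗₀ C) (A ⊗₀ (B ⊗₀ C))
    α⇐ : ∀ {A B C} → Hom (A ⊗₀ (B ⊗₀ C)) ((A ⊗₀ B) ⊗₀ C)
    σ  : ∀ {A B} → Hom (A ⊗₀ B) (B ⊗₀ A)
    λ-isoˡ : ∀ {A} → λ⇐ ∘ λ⇒ {A} ≈ id
    λ-isoʳ : ∀ {A} → λ⇒ ∘ λ⇐ {A} ≈ id
    ρ-isoˡ : ∀ {A} → ρ⇐ ∘ ρ⇒ {A} ≈ id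
    ρ-isoʳ : ∀ {A} → ρ⇒ ∘ ρ⇐ {A} ≈ id
    α-isoˡ : ∀ {A B C} → α⇐ ∘ α⇒ {A} {B} {C} ≈ id
    α-isoʳ : ∀ {A B C} → α⇒ ∘ α⇐ {A} {B} {C} ≈ id
    σ-inv  : ∀ {A B} → σ ∘ σ {A} {B} ≈ id
    λ-natural : ∀ {A B} {f : Hom A B} → λ⇒ ∘ (id ⊗₁ f) ≈ f ∘ λ⇒
    ρ-natural : ∀ {A B} {f : Hom A B} → ρ⇒ ∘ (f ⊗₁ id) ≈ f ∘ ρ⇒
    α-natural : ∀ {A B C D E F} {f : Hom A D} {g : Hom B E} {h : Hom C F} →
                α⇒ ∘ ((f ⊗₁ g) ⊗₁ h) ≈ (f ⊗₁ (g ⊗₁ h)) ∘ α⇒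
    σ-natural : ∀ {A B C D} {f : Hom A C} {g : Hom B D} →
                σ ∘ (f ⊗₁ g) ≈ (g ⊗₁ f) ∘ σ
    triangle : ∀ {A B} → (id {A} ⊗₁ λ⇒ {B}) ∘ α⇒ ≈ ρ⇒ ⊗₁ id
    pentagon : ∀ {A B C D} →
               (id {A} ⊗₁ α⇒ {B} {C} {D}) ∘ (α⇒ ∘ (α⇒ ⊗₁ id)) ≈ α⇒ ∘ α⇒
    hexagon : ∀ {A B C} →
              (id {B} ⊗₁ σ {A} {C}) ∘ (α⇒ ∘ (σ ⊗₁ id)) ≈ α⇒ ∘ (σ ∘ α⇒)

    _⊸_ : Ob → Ob → Ob
    ev  : ∀ {A B} → Hom ((A ⊸ B) ⊗₀ A) B
    cur : ∀ {A B C} → Hom (C ⊗₀ A) B → Hom C (A ⊸ B)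
    cur-β : ∀ {A B C} {f : Hom (C ⊗₀ A) B} → ev ∘ (cur f ⊗₁ id) ≈ f
    cur-unique : ∀ {A B C} {f : Hom (C ⊗₀ A) B} {g : Hom C (A ⊸ B)} →
                 ev ∘ (g ⊗₁ id) ≈ f → g ≈ cur f

    ⊥ : Ob
    ∂⁻¹ : ∀ {A} → Hom ((A ⊸ ⊥) ⊸ ⊥) A
    ∂-isoˡ : ∀ {A} → ∂⁻¹ ∘ cur (ev ∘ σ) ≈ id {A}
    ∂-isoʳ : ∀ {A} → cur (ev ∘ σ) ∘ ∂⁻¹ ≈ id {(A ⊸ ⊥) ⊸ ⊥}

    ⊤ : Ob
    ! : ∀ {A} → Hom A ⊤
    !-unique : ∀ {A} (f : Hom A ⊤) → f ≈ !
    _&_ : Ob → Ob → Ob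
    π₁ : ∀ {A B} → Hom (A & B) A
    π₂ : ∀ {A B} → Hom (A & B) B
    ⟨_,_⟩ : ∀ {A B C} → Hom C A → Hom C B → Hom C (A & B)
    project₁ : ∀ {A B C} {f : Hom C A} {g : Hom C B} → π₁ ∘ ⟨ f , g ⟩ ≈ f
    project₂ : ∀ {A B C} {f : Hom C A} {g : Hom C B} → π₂ ∘ ⟨ f , g ⟩ ≈ g
    ⟨⟩-unique : ∀ {A B C} {f : Hom C A} {g : Hom C B} {h : Hom C (A & B)} →
                π₁ ∘ h ≈ f → π₂ ∘ h ≈ g → h ≈ ⟨ f , g ⟩

    ¡ : ∀ {A} → Hom ⊤ A
    ¡-unique : ∀ {A} (f : Hom ⊤ A) → f ≈ ¡

    !₀ : Ob → Ob
    !₁ : ∀ {A B} → Hom A B → Hom (!₀ A) (!₀ B)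
    !-id : ∀ {A} → !₁ (id {A}) ≈ id
    !-∘  : ∀ {A B C} {f : Hom B C} {g : Hom A B} → !₁ (f ∘ g) ≈ !₁ f ∘ !₁ g
    !-resp-≈ : ∀ {A B} {f g : Hom A B} → f ≈ g → !₁ f ≈ !₁ g
    der : ∀ {A} → Hom (!₀ A) A
    dig : ∀ {A} → Hom (!₀ A) (!₀ (!₀ A))
    der-natural : ∀ {A B} {f : Hom A B} → der ∘ !₁ f ≈ f ∘ der
    dig-natural : ∀ {A B} {f : Hom A B} → dig ∘ !₁ f ≈ !₁ (!₁ f) ∘ dig
    comonad-idˡ : ∀ {A} → der ∘ dig {A} ≈ id
    comonad-idʳ : ∀ {A} → !₁ der ∘ dig {A} ≈ id
    comonad-assoc : ∀ {A} → dig ∘ dig {A} ≈ !₁ dig ∘ dig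

    m⁰ : Hom 𝟙 (!₀ ⊤)
    m⁰⁻¹ : Hom (!₀ ⊤) 𝟙
    m⁰-isoˡ : m⁰⁻¹ ∘ m⁰ ≈ id
    m⁰-isoʳ : m⁰ ∘ m⁰⁻¹ ≈ id
    m² : ∀ {A B} → Hom (!₀ A ⊗₀ !₀ B) (!₀ (A & B))
    m²⁻¹ : ∀ {A B} → Hom (!₀ (A & B)) (!₀ A ⊗₀ !₀ B)
    m²-isoˡ : ∀ {A B} → m²⁻¹ ∘ m² {A} {B} ≈ id
    m²-isoʳ : ∀ {A B} → m² ∘ m²⁻¹ {A} {B} ≈ id
    m²-natural : ∀ {A B C D} {f : Hom A C} {g : Hom B D} →
                 m² ∘ (!₁ f ⊗₁ !₁ g) ≈ !₁ ⟨ f ∘ π₁ , g ∘ π₂ ⟩ ∘ m²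
    m-assoc : ∀ {A B C} →
              !₁ ⟨ π₁ ∘ π₁ , ⟨ π₂ ∘ π₁ , π₂ ⟩ ⟩ ∘ (m² {A & B} {C} ∘ (m² ⊗₁ id))
              ≈ m² {A} {B & C} ∘ ((id ⊗₁ m²) ∘ α⇒)
    m-unitˡ : ∀ {A} → !₁ π₂ ∘ (m² {⊤} {A} ∘ (m⁰ ⊗₁ id)) ≈ λ⇒
    m-unitʳ : ∀ {A} → !₁ π₁ ∘ (m² {A} {⊤} ∘ (id ⊗₁ m⁰)) ≈ ρ⇒
    m-symm  : ∀ {A B} → !₁ ⟨ π₂ , π₁ ⟩ ∘ m² {A} {B} ≈ m² ∘ σ
    m²-dig : ∀ {A B} →
             !₁ ⟨ !₁ π₁ , !₁ π₂ ⟩ ∘ (dig ∘ m² {A} {B}) ≈ m² ∘ (dig ⊗₁ dig)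
    m⁰-dig : !₁ ! ∘ (dig ∘ m⁰) ≈ m⁰

    𝒰 : Ob
    𝒰-eq : 𝒰 ≡ (!₀ 𝒰 & (!₀ 𝒰 ⊸ 𝒰))

-- Variables are de Bruijn levels: in a context x⃗ = (x₁,…,x_k)
-- (repetition-free by construction), a variable is an element of Var k;
-- 'last' is x_k and 'weak v' is v seen in the extended context.  A binder
-- λ in context k binds the new variable x_{k+1} (the context x⃗,y).

data Var : ℕ → Set where
  last : ∀ {k} → Var (1+ k)
  weak : ∀ {k} → Var k → Var (1+ k)

data Λ (k : ℕ) : Set where
  var : Var k → Λ k
  lam : Λ (1+ k) → Λ k
  app : Λ k → Λ k → Λ k

data BTm (k : ℕ) : Set where
  var  : Var k → BTm k
  lam  : BTm (1+ k) → BTm k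
  app  : BTm k → BTm k → BTm k
  dr   : BTm k → BTm k
  bang : BTm k → BTm k

cbn : ∀ {k} → Λ k → BTm k
cbn (var x)   = var x
cbn (lam t)   = lam (cbn t)
cbn (app t s) = app (cbn t) (bang (cbn s))

module Interp {o ℓ e} (M : LLModel o ℓ e) where
  open LLModel M

  unfold𝒰 : Hom 𝒰 (!₀ 𝒰 & (!₀ 𝒰 ⊸ 𝒰))
  unfold𝒰 = subst (Hom 𝒰) 𝒰-eq id
  fold𝒰 : Hom (!₀ 𝒰 & (!₀ 𝒰 ⊸ 𝒰)) 𝒰
  fold𝒰 = subst (λ Z → Hom Z 𝒰) 𝒰-eq id

  0m : ∀ {X Y} → Hom X Y
  0m = ¡ ∘ !

  !𝒰^ : ℕ → Ob
  !𝒰^ zero   = 𝟙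
  !𝒰^ (1+ k) = !𝒰^ k ⊗₀ !₀ 𝒰

  𝒰^ : ℕ → Ob
  𝒰^ zero   = ⊤
  𝒰^ (1+ k) = 𝒰^ k & 𝒰

  w : ∀ {X} → Hom (!₀ X) 𝟙
  w = m⁰⁻¹ ∘ !₁ !

  wAll : ∀ k → Hom (!𝒰^ k) 𝟙
  wAll zero   = id
  wAll (1+ k) = ρ⇒ ∘ (wAll k ⊗₁ w)

  φ : ∀ k → Hom (!𝒰^ k) (!₀ (𝒰^ k))
  φ zero   = m⁰
  φ (1+ k) = m² ∘ (φ k ⊗₁ id)

  φ⁻¹ : ∀ k → Hom (!₀ (𝒰^ k)) (!𝒰^ k)
  φ⁻¹ zero   = m⁰⁻¹
  φ⁻¹ (1+ k) = (φ⁻¹ k ⊗₁ id) ∘ m²⁻¹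

  -- coalgebra structure p and contraction c on (!𝒰)^{⊗k}
  -- (those of the free coalgebra !(𝒰^k), transported along φ_k)
  p : ∀ k → Hom (!𝒰^ k) (!₀ (!𝒰^ k))
  p k = !₁ (φ⁻¹ k) ∘ (dig ∘ φ k)

  c : ∀ k → Hom (!𝒰^ k) (!𝒰^ k ⊗₀ !𝒰^ k)
  c k = (φ⁻¹ k ⊗₁ φ⁻¹ k) ∘ (m²⁻¹ ∘ (!₁ ⟨ id , id ⟩ ∘ φ k))

  -- [x_i]_{x⃗} = w^{⊗ i-1} ⊗ der ⊗ w^{⊗ k-i}  (up to unit isos)
  ⟦var⟧ : ∀ {k} → Var k → Hom (!𝒰^ k) 𝒰
  ⟦var⟧ {1+ k} last     = λ⇒ ∘ (wAll k ⊗₁ der)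
  ⟦var⟧ {1+ k} (weak v) = ρ⇒ ∘ (⟦var⟧ v ⊗₁ w)

  ⟦_⟧ᵇ : ∀ {k} → BTm k → Hom (!𝒰^ k) 𝒰
  ⟦ var x ⟧ᵇ       = ⟦var⟧ x
  ⟦ lam S ⟧ᵇ       = fold𝒰 ∘ ⟨ 0m , cur ⟦ S ⟧ᵇ ⟩
  ⟦_⟧ᵇ {k} (app S R) = ev ∘ (((π₂ ∘ (unfold𝒰 ∘ ⟦ S ⟧ᵇ)) ⊗₁ (π₁ ∘ (unfold𝒰 ∘ ⟦ R ⟧ᵇ))) ∘ c k)
  ⟦ dr S ⟧ᵇ        = der ∘ (π₁ ∘ (unfold𝒰 ∘ ⟦ S ⟧ᵇ))
  ⟦_⟧ᵇ {k} (bang S)  = fold𝒰 ∘ ⟨ !₁ ⟦ S ⟧ᵇ ∘ p k , 0m ⟩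

  infixr 9 _∘!_
  _∘!_ : ∀ {A B C} → Hom (!₀ B) C → Hom (!₀ A) B → Hom (!₀ A) C
  f ∘! g = f ∘ (!₁ g ∘ dig)

  Ev : ∀ {A B} → Hom (!₀ ((!₀ A ⊸ B) & A)) B
  Ev = ev ∘ ((der ⊗₁ id) ∘ m²⁻¹)

  Cur : ∀ {A B C} → Hom (!₀ (C & A)) B → Hom (!₀ C) (!₀ A ⊸ B)
  Cur f = cur (f ∘ m²)

  λ𝒰 : Hom (!₀ 𝒰 ⊸ 𝒰) 𝒰
  λ𝒰 = fold𝒰 ∘ ⟨ 0m , id ⟩

  app𝒰 : Hom 𝒰 (!₀ 𝒰 ⊸ 𝒰)
  app𝒰 = π₂ ∘ unfold𝒰

  appₙ : Hom (!₀ 𝒰) (!₀ 𝒰 ⊸ 𝒰)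
  appₙ = der ∘ !₁ app𝒰

  λₙ : Hom (!₀ (!₀ 𝒰 ⊸ 𝒰)) 𝒰
  λₙ = der ∘ !₁ λ𝒰

  proj : ∀ {k} → Var k → Hom (𝒰^ k) 𝒰
  proj last     = π₂
  proj (weak v) = proj v ∘ π₁

  πᵏ : ∀ {k} → Var k → Hom (!₀ (𝒰^ k)) 𝒰
  πᵏ v = proj v ∘ der

  ⟦_⟧ⁿ : ∀ {k} → Λ k → Hom (!₀ (𝒰^ k)) 𝒰
  ⟦ var x ⟧ⁿ   = πᵏ x
  ⟦ lam t ⟧ⁿ   = λₙ ∘! Cur ⟦ t ⟧ⁿ
  ⟦ app t s ⟧ⁿ = Ev ∘! ⟨ appₙ ∘! ⟦ t ⟧ⁿ , ⟦ s ⟧ⁿ ⟩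

  CbN-Correct : ∀ {k} → Λ k → Set e
  CbN-Correct {k} t = ⟦ cbn t ⟧ᵇ ≈ ⟦ t ⟧ⁿ ∘ φ k

module Submission where

open import Defs
open import Data.Nat using (ℕ; zero; suc)
open import Relation.Binary.PropositionalEquality as ≡ using (_≡_; subst)
open import Relation.Binary.Bundles using (Setoid)
import Relation.Binary.Reasoning.Setoid as SetoidReasoning

-- For a variable, dereliction after
-- φ_{k+1} = m² ∘ (φ_k ⊗ id) projects onto one tensor factor and weakens the
-- other (Seely unit laws), which is how ⟦x_i⟧ is built.  For an abstraction,
-- Kleisli currying satisfies Cur f ∘ φ_k = cur (f ∘ φ_{k+1}).  For an
-- application, p and c are the coalgebra and contraction of !(𝒰^k)
-- transported along φ_k, and Kleisli evaluation Ev ∘! ⟨f , g⟩ unfolds to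
-- ev ∘ (f ⊗ (!g ∘ dig)) ∘ contraction, because contraction m²⁻¹ ∘ !⟨id , id⟩
-- commutes with digging (coherence of the Seely isomorphisms with dig).

module CbN {o ℓ e} (M : LLModel o ℓ e) where
  open LLModel M
  open Interp M

  hom-setoid : ∀ {A B} → Setoid ℓ e
  hom-setoid {A} {B} = record { Carrier = Hom A B ; _≈_ = _≈_ ; isEquivalence = ≈-equiv }

  open module HomReasoning {A B} = SetoidReasoning (hom-setoid {A} {B})
  open module HomEquality {A B} = Setoid (hom-setoid {A} {B}) using (refl; sym; trans)

  private
    variable
      A B C D X Y : Ob
      f : Hom A B

  infixr 4 _⟩∘⟨_ refl⟩∘⟨_
  infixl 5 _⟩∘⟨refl

  _⟩∘⟨_ : ∀ {f h : Hom B C} {g i : Hom A B} → f ≈ h → g ≈ i → f ∘ g ≈ h ∘ i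
  _⟩∘⟨_ = ∘-resp-≈

  refl⟩∘⟨_ : ∀ {f : Hom B C} {g i : Hom A B} → g ≈ i → f ∘ g ≈ f ∘ i
  refl⟩∘⟨ p = refl ⟩∘⟨ p

  _⟩∘⟨refl : ∀ {f h : Hom B C} {g : Hom A B} → f ≈ h → f ∘ g ≈ h ∘ g
  p ⟩∘⟨refl = p ⟩∘⟨ refl

  assoc˘ : ∀ {f : Hom A B} {g : Hom B C} {h : Hom C D} → h ∘ (g ∘ f) ≈ (h ∘ g) ∘ f
  assoc˘ = sym assoc

  pullˡ : ∀ {a : Hom B C} {b : Hom A B} {c : Hom A C} {f : Hom X A} →
          a ∘ b ≈ c → a ∘ (b ∘ f) ≈ c ∘ f
  pullˡ p = trans assoc˘ (p ⟩∘⟨refl)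

  pullʳ : ∀ {a : Hom B C} {b : Hom A B} {c : Hom X A} {d : Hom X B} →
          b ∘ c ≈ d → (a ∘ b) ∘ c ≈ a ∘ d
  pullʳ p = trans assoc (refl⟩∘⟨ p)

  cancelˡ : ∀ {a : Hom B A} {b : Hom A B} {f : Hom X A} → a ∘ b ≈ id → a ∘ (b ∘ f) ≈ f
  cancelˡ p = trans (pullˡ p) identityˡ

  cancelʳ : ∀ {a : Hom A X} {b : Hom B A} {c : Hom A B} → b ∘ c ≈ id → (a ∘ b) ∘ c ≈ a
  cancelʳ p = trans (pullʳ p) identityʳ

  flip-iso-square : ∀ {i : Hom A B} {i⁻¹ : Hom B A} {j : Hom C D} {j⁻¹ : Hom D C}
                    {x : Hom C A} {y : Hom D B} →
                    i⁻¹ ∘ i ≈ id → j ∘ j⁻¹ ≈ id → i ∘ x ≈ y ∘ j → i⁻¹ ∘ y ≈ x ∘ j⁻¹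
  flip-iso-square {i = i} {i⁻¹} {j} {j⁻¹} {x} {y} i⁻¹i j⁻¹j square = begin
    i⁻¹ ∘ y                  ≈⟨ refl⟩∘⟨ trans (refl⟩∘⟨ j⁻¹j) identityʳ ⟨
    i⁻¹ ∘ (y ∘ (j ∘ j⁻¹))    ≈⟨ refl⟩∘⟨ pullˡ (sym square) ⟩
    i⁻¹ ∘ ((i ∘ x) ∘ j⁻¹)    ≈⟨ trans (refl⟩∘⟨ assoc) (cancelˡ i⁻¹i) ⟩
    x ∘ j⁻¹                  ∎

  ⊗-merge : ∀ {f : Hom B C} {g : Hom A B} {h : Hom Y D} {k : Hom X Y} →
            (f ⊗₁ h) ∘ (g ⊗₁ k) ≈ (f ∘ g) ⊗₁ (h ∘ k)
  ⊗-merge = sym ⊗-∘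

  serialize₁₂ : ∀ {f : Hom A B} {g : Hom C D} → f ⊗₁ g ≈ (f ⊗₁ id) ∘ (id ⊗₁ g)
  serialize₁₂ = sym (trans ⊗-merge (⊗-resp-≈ identityʳ identityˡ))

  serialize₂₁ : ∀ {f : Hom A B} {g : Hom C D} → f ⊗₁ g ≈ (id ⊗₁ g) ∘ (f ⊗₁ id)
  serialize₂₁ = sym (trans ⊗-merge (⊗-resp-≈ identityˡ identityʳ))

  ⟨⟩∘ : ∀ {f : Hom C A} {g : Hom C B} {h : Hom D C} → ⟨ f , g ⟩ ∘ h ≈ ⟨ f ∘ h , g ∘ h ⟩
  ⟨⟩∘ = ⟨⟩-unique (pullˡ project₁) (pullˡ project₂)

  ⟨⟩-cong : ∀ {f f' : Hom C A} {g g' : Hom C B} → f ≈ f' → g ≈ g' → ⟨ f , g ⟩ ≈ ⟨ f' , g' ⟩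
  ⟨⟩-cong p q = ⟨⟩-unique (trans project₁ p) (trans project₂ q)

  ⟨⟩-factor : ∀ {f : Hom C A} {g : Hom C B} → ⟨ f , g ⟩ ≈ ⟨ f ∘ π₁ , g ∘ π₂ ⟩ ∘ ⟨ id , id ⟩
  ⟨⟩-factor = sym (trans ⟨⟩∘ (⟨⟩-cong (cancelʳ project₁) (cancelʳ project₂)))

  cur-cong : ∀ {f g : Hom (C ⊗₀ A) B} → f ≈ g → cur f ≈ cur g
  cur-cong p = cur-unique (trans cur-β p)

  cur-natural : ∀ {f : Hom (C ⊗₀ A) B} {g : Hom D C} → cur f ∘ g ≈ cur (f ∘ (g ⊗₁ id))
  cur-natural = cur-unique (trans (refl⟩∘⟨ trans (⊗-resp-≈ refl (sym identityˡ)) ⊗-∘)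
                                  (pullˡ cur-β))

  0m-absorbʳ : ∀ {h : Hom X A} → 0m {A} {B} ∘ h ≈ 0m
  0m-absorbʳ {h = h} = pullʳ (!-unique (! ∘ h))

  subst-section : (eq : A ≡ B) → subst (Hom A) eq id ∘ subst (λ Z → Hom Z A) eq id ≈ id
  subst-section ≡.refl = identityˡ

  unfold𝒰∘fold𝒰 : unfold𝒰 ∘ fold𝒰 ≈ id
  unfold𝒰∘fold𝒰 = subst-section 𝒰-eq

  λ𝒰∘ : ∀ {g : Hom X (!₀ 𝒰 ⊸ 𝒰)} → λ𝒰 ∘ g ≈ fold𝒰 ∘ ⟨ 0m , g ⟩
  λ𝒰∘ = pullʳ (trans ⟨⟩∘ (⟨⟩-cong 0m-absorbʳ identityˡ))

  w-natural : w ∘ !₁ f ≈ w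
  w-natural {f = f} = pullʳ (trans (sym !-∘) (!-resp-≈ (!-unique (! ∘ f))))

  !₁!≈m⁰∘w : !₁ (! {A}) ≈ m⁰ ∘ w
  !₁!≈m⁰∘w = sym (trans (pullˡ m⁰-isoʳ) identityˡ)

  !π₁∘m² : !₁ π₁ ∘ m² {A} {B} ≈ ρ⇒ ∘ (id ⊗₁ w)
  !π₁∘m² = begin
    !₁ π₁ ∘ m²                                   ≈⟨ !-resp-≈ (trans project₁ identityˡ) ⟩∘⟨refl ⟨
    !₁ (π₁ ∘ ⟨ id ∘ π₁ , ! ∘ π₂ ⟩) ∘ m²          ≈⟨ trans (!-∘ ⟩∘⟨refl) assoc ⟩
    !₁ π₁ ∘ (!₁ ⟨ id ∘ π₁ , ! ∘ π₂ ⟩ ∘ m²)       ≈⟨ refl⟩∘⟨ m²-natural ⟨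
    !₁ π₁ ∘ (m² ∘ (!₁ id ⊗₁ !₁ !))               ≈⟨ refl⟩∘⟨ refl⟩∘⟨ ⊗-resp-≈ !-id !₁!≈m⁰∘w ⟩
    !₁ π₁ ∘ (m² ∘ (id ⊗₁ (m⁰ ∘ w)))              ≈⟨ refl⟩∘⟨ refl⟩∘⟨ trans ⊗-merge (⊗-resp-≈ identityˡ refl) ⟨
    !₁ π₁ ∘ (m² ∘ ((id ⊗₁ m⁰) ∘ (id ⊗₁ w)))      ≈⟨ trans (refl⟩∘⟨ assoc˘) (pullˡ m-unitʳ) ⟩
    ρ⇒ ∘ (id ⊗₁ w)                               ∎

  !π₂∘m² : !₁ π₂ ∘ m² {A} {B} ≈ λ⇒ ∘ (w ⊗₁ id)
  !π₂∘m² = begin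
    !₁ π₂ ∘ m²                                   ≈⟨ !-resp-≈ (trans project₂ identityˡ) ⟩∘⟨refl ⟨
    !₁ (π₂ ∘ ⟨ ! ∘ π₁ , id ∘ π₂ ⟩) ∘ m²          ≈⟨ trans (!-∘ ⟩∘⟨refl) assoc ⟩
    !₁ π₂ ∘ (!₁ ⟨ ! ∘ π₁ , id ∘ π₂ ⟩ ∘ m²)       ≈⟨ refl⟩∘⟨ m²-natural ⟨
    !₁ π₂ ∘ (m² ∘ (!₁ ! ⊗₁ !₁ id))               ≈⟨ refl⟩∘⟨ refl⟩∘⟨ ⊗-resp-≈ !₁!≈m⁰∘w !-id ⟩
    !₁ π₂ ∘ (m² ∘ ((m⁰ ∘ w) ⊗₁ id))              ≈⟨ refl⟩∘⟨ refl⟩∘⟨ trans ⊗-merge (⊗-resp-≈ refl identityˡ) ⟨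
    !₁ π₂ ∘ (m² ∘ ((m⁰ ⊗₁ id) ∘ (w ⊗₁ id)))      ≈⟨ trans (refl⟩∘⟨ assoc˘) (pullˡ m-unitˡ) ⟩
    λ⇒ ∘ (w ⊗₁ id)                               ∎

  ∘-!π₁∘m² : ∀ {g : Hom (!₀ A) X} → g ∘ (!₁ π₁ ∘ m² {A} {B}) ≈ ρ⇒ ∘ (g ⊗₁ w)
  ∘-!π₁∘m² {g = g} = begin
    g ∘ (!₁ π₁ ∘ m²)               ≈⟨ refl⟩∘⟨ !π₁∘m² ⟩
    g ∘ (ρ⇒ ∘ (id ⊗₁ w))           ≈⟨ pullˡ (sym ρ-natural) ⟩
    (ρ⇒ ∘ (g ⊗₁ id)) ∘ (id ⊗₁ w)   ≈⟨ pullʳ (sym serialize₁₂) ⟩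
    ρ⇒ ∘ (g ⊗₁ w)                  ∎

  ∘-!π₂∘m² : ∀ {g : Hom (!₀ B) X} → g ∘ (!₁ π₂ ∘ m² {A} {B}) ≈ λ⇒ ∘ (w ⊗₁ g)
  ∘-!π₂∘m² {g = g} = begin
    g ∘ (!₁ π₂ ∘ m²)               ≈⟨ refl⟩∘⟨ !π₂∘m² ⟩
    g ∘ (λ⇒ ∘ (w ⊗₁ id))           ≈⟨ pullˡ (sym λ-natural) ⟩
    (λ⇒ ∘ (id ⊗₁ g)) ∘ (w ⊗₁ id)   ≈⟨ pullʳ (sym serialize₂₁) ⟩
    λ⇒ ∘ (w ⊗₁ g)                  ∎

  w∘m² : w ∘ m² {A} {B} ≈ ρ⇒ ∘ (w ⊗₁ w)
  w∘m² = trans (sym (w-natural {f = π₁}) ⟩∘⟨refl) (trans assoc ∘-!π₁∘m²)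

  der-π₁-m² : ∀ {h : Hom A X} → ((h ∘ π₁) ∘ der) ∘ m² {A} {B} ≈ ρ⇒ ∘ ((h ∘ der) ⊗₁ w)
  der-π₁-m² = trans (trans (pullʳ (sym der-natural)) assoc˘ ⟩∘⟨refl) (trans assoc ∘-!π₁∘m²)

  der-π₂-m² : (π₂ ∘ der) ∘ m² {A} {B} ≈ λ⇒ ∘ (w ⊗₁ der)
  der-π₂-m² = trans (sym der-natural ⟩∘⟨refl) (trans assoc ∘-!π₂∘m²)

  w∘φ : ∀ k → w ∘ φ k ≈ wAll k
  w∘φ zero = trans (trans (refl⟩∘⟨ trans (!-resp-≈ (sym (!-unique id))) !-id) identityʳ ⟩∘⟨refl)
                   m⁰-isoˡ
  w∘φ (suc k) = begin
    w ∘ (m² ∘ (φ k ⊗₁ id))          ≈⟨ pullˡ w∘m² ⟩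
    (ρ⇒ ∘ (w ⊗₁ w)) ∘ (φ k ⊗₁ id)   ≈⟨ pullʳ ⊗-merge ⟩
    ρ⇒ ∘ ((w ∘ φ k) ⊗₁ (w ∘ id))    ≈⟨ refl⟩∘⟨ ⊗-resp-≈ (w∘φ k) identityʳ ⟩
    ρ⇒ ∘ (wAll k ⊗₁ w)              ∎

  φ∘φ⁻¹ : ∀ k → φ k ∘ φ⁻¹ k ≈ id
  φ∘φ⁻¹ zero    = m⁰-isoʳ
  φ∘φ⁻¹ (suc k) = trans (pullʳ (cancelˡ φk⊗id∘φk⁻¹⊗id)) m²-isoʳ
    where
    φk⊗id∘φk⁻¹⊗id : (φ k ⊗₁ id) ∘ (φ⁻¹ k ⊗₁ id) ≈ id
    φk⊗id∘φk⁻¹⊗id = trans ⊗-merge (trans (⊗-resp-≈ (φ∘φ⁻¹ k) identityˡ) ⊗-id)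

  ⟦var⟧≈πᵏ∘φ : ∀ {k} (v : Var k) → ⟦var⟧ v ≈ πᵏ v ∘ φ k
  ⟦var⟧≈πᵏ∘φ {suc k} last = sym (begin
    (π₂ ∘ der) ∘ (m² ∘ (φ k ⊗₁ id))   ≈⟨ pullˡ der-π₂-m² ⟩
    (λ⇒ ∘ (w ⊗₁ der)) ∘ (φ k ⊗₁ id)   ≈⟨ pullʳ ⊗-merge ⟩
    λ⇒ ∘ ((w ∘ φ k) ⊗₁ (der ∘ id))    ≈⟨ refl⟩∘⟨ ⊗-resp-≈ (w∘φ k) identityʳ ⟩
    λ⇒ ∘ (wAll k ⊗₁ der)              ∎)
  ⟦var⟧≈πᵏ∘φ {suc k} (weak v) = begin
    ρ⇒ ∘ (⟦var⟧ v ⊗₁ w)                          ≈⟨ refl⟩∘⟨ ⊗-resp-≈ (⟦var⟧≈πᵏ∘φ v) (sym identityʳ) ⟩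
    ρ⇒ ∘ ((πᵏ v ∘ φ k) ⊗₁ (w ∘ id))              ≈⟨ trans (refl⟩∘⟨ ⊗-∘) assoc˘ ⟩
    (ρ⇒ ∘ (πᵏ v ⊗₁ w)) ∘ (φ k ⊗₁ id)             ≈⟨ der-π₁-m² ⟩∘⟨refl ⟨
    (((proj v ∘ π₁) ∘ der) ∘ m²) ∘ (φ k ⊗₁ id)   ≈⟨ assoc ⟩
    πᵏ (weak v) ∘ φ (suc k)                      ∎

  der-∘! : ∀ {g : Hom (!₀ A) B} → der ∘! g ≈ g
  der-∘! = trans (pullˡ der-natural) (cancelʳ comonad-idˡ)

  der∘!₁-∘! : ∀ {f : Hom B C} {g : Hom (!₀ A) B} → (der ∘ !₁ f) ∘! g ≈ f ∘ g
  der∘!₁-∘! = trans (der-natural ⟩∘⟨refl) (pullʳ der-∘!)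

  contraction : Hom (!₀ A) (!₀ A ⊗₀ !₀ A)
  contraction = m²⁻¹ ∘ !₁ ⟨ id , id ⟩

  m²⁻¹-natural : ∀ {f : Hom A C} {g : Hom B D} →
                 m²⁻¹ ∘ !₁ ⟨ f ∘ π₁ , g ∘ π₂ ⟩ ≈ (!₁ f ⊗₁ !₁ g) ∘ m²⁻¹
  m²⁻¹-natural = flip-iso-square m²-isoˡ m²-isoʳ m²-natural

  ⟨!π₁,!π₂⟩∘!Δ : ⟨ !₁ π₁ , !₁ π₂ ⟩ ∘ !₁ ⟨ id , id ⟩ ≈ ⟨ id , id { !₀ A } ⟩
  ⟨!π₁,!π₂⟩∘!Δ = trans ⟨⟩∘ (⟨⟩-cong (!-∘-id project₁) (!-∘-id project₂))
    where
    !-∘-id : ∀ {f : Hom B A} {g : Hom A B} → f ∘ g ≈ id → !₁ f ∘ !₁ g ≈ id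
    !-∘-id fg = trans (sym !-∘) (trans (!-resp-≈ fg) !-id)

  contraction-dig : contraction ∘ dig {A} ≈ (dig ⊗₁ dig) ∘ contraction
  contraction-dig = begin
    (m²⁻¹ ∘ !₁ ⟨ id , id ⟩) ∘ dig
      ≈⟨ assoc ⟩
    m²⁻¹ ∘ (!₁ ⟨ id , id ⟩ ∘ dig)
      ≈⟨ refl⟩∘⟨ (!-resp-≈ ⟨!π₁,!π₂⟩∘!Δ ⟩∘⟨refl) ⟨
    m²⁻¹ ∘ (!₁ (⟨ !₁ π₁ , !₁ π₂ ⟩ ∘ !₁ ⟨ id , id ⟩) ∘ dig)
      ≈⟨ refl⟩∘⟨ trans (!-∘ ⟩∘⟨refl) assoc ⟩
    m²⁻¹ ∘ (!₁ ⟨ !₁ π₁ , !₁ π₂ ⟩ ∘ (!₁ (!₁ ⟨ id , id ⟩) ∘ dig))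
      ≈⟨ refl⟩∘⟨ refl⟩∘⟨ dig-natural ⟨
    m²⁻¹ ∘ (!₁ ⟨ !₁ π₁ , !₁ π₂ ⟩ ∘ (dig ∘ !₁ ⟨ id , id ⟩))
      ≈⟨ trans (refl⟩∘⟨ assoc˘) assoc˘ ⟩
    (m²⁻¹ ∘ (!₁ ⟨ !₁ π₁ , !₁ π₂ ⟩ ∘ dig)) ∘ !₁ ⟨ id , id ⟩
      ≈⟨ flip-iso-square m²-isoˡ m²-isoʳ (sym (trans assoc m²-dig)) ⟩∘⟨refl ⟩
    ((dig ⊗₁ dig) ∘ m²⁻¹) ∘ !₁ ⟨ id , id ⟩
      ≈⟨ assoc ⟩
    (dig ⊗₁ dig) ∘ contraction
      ∎

  m²⁻¹∘!⟨⟩∘dig : ∀ {f : Hom (!₀ A) B} {g : Hom (!₀ A) C} →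
                 m²⁻¹ ∘ (!₁ ⟨ f , g ⟩ ∘ dig) ≈ ((!₁ f ∘ dig) ⊗₁ (!₁ g ∘ dig)) ∘ contraction
  m²⁻¹∘!⟨⟩∘dig {f = f} {g} = begin
    m²⁻¹ ∘ (!₁ ⟨ f , g ⟩ ∘ dig)
      ≈⟨ refl⟩∘⟨ (trans (!-resp-≈ ⟨⟩-factor) !-∘ ⟩∘⟨refl) ⟩
    m²⁻¹ ∘ ((!₁ ⟨ f ∘ π₁ , g ∘ π₂ ⟩ ∘ !₁ ⟨ id , id ⟩) ∘ dig)
      ≈⟨ trans (refl⟩∘⟨ assoc) assoc˘ ⟩
    (m²⁻¹ ∘ !₁ ⟨ f ∘ π₁ , g ∘ π₂ ⟩) ∘ (!₁ ⟨ id , id ⟩ ∘ dig)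
      ≈⟨ m²⁻¹-natural ⟩∘⟨refl ⟩
    ((!₁ f ⊗₁ !₁ g) ∘ m²⁻¹) ∘ (!₁ ⟨ id , id ⟩ ∘ dig)
      ≈⟨ trans assoc (refl⟩∘⟨ assoc˘) ⟩
    (!₁ f ⊗₁ !₁ g) ∘ (contraction ∘ dig)
      ≈⟨ refl⟩∘⟨ contraction-dig ⟩
    (!₁ f ⊗₁ !₁ g) ∘ ((dig ⊗₁ dig) ∘ contraction)
      ≈⟨ pullˡ ⊗-merge ⟩
    ((!₁ f ∘ dig) ⊗₁ (!₁ g ∘ dig)) ∘ contraction
      ∎

  Ev-∘! : ∀ {f : Hom (!₀ X) (!₀ A ⊸ B)} {g : Hom (!₀ X) A} →
          Ev ∘! ⟨ f , g ⟩ ≈ ev ∘ ((f ⊗₁ (!₁ g ∘ dig)) ∘ contraction)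
  Ev-∘! {f = f} {g} = begin
    (ev ∘ ((der ⊗₁ id) ∘ m²⁻¹)) ∘ (!₁ ⟨ f , g ⟩ ∘ dig)
      ≈⟨ pullʳ (pullʳ m²⁻¹∘!⟨⟩∘dig) ⟩
    ev ∘ ((der ⊗₁ id) ∘ (((!₁ f ∘ dig) ⊗₁ (!₁ g ∘ dig)) ∘ contraction))
      ≈⟨ refl⟩∘⟨ pullˡ (trans ⊗-merge (⊗-resp-≈ der-∘! identityˡ)) ⟩
    ev ∘ ((f ⊗₁ (!₁ g ∘ dig)) ∘ contraction)
      ∎

  !₁∘φ∘p : ∀ k {f : Hom (!₀ (𝒰^ k)) A} → !₁ (f ∘ φ k) ∘ p k ≈ (!₁ f ∘ dig) ∘ φ k
  !₁∘φ∘p k {f} = begin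
    !₁ (f ∘ φ k) ∘ (!₁ (φ⁻¹ k) ∘ (dig ∘ φ k))   ≈⟨ pullˡ (sym !-∘) ⟩
    !₁ ((f ∘ φ k) ∘ φ⁻¹ k) ∘ (dig ∘ φ k)        ≈⟨ !-resp-≈ (cancelʳ (φ∘φ⁻¹ k)) ⟩∘⟨refl ⟩
    !₁ f ∘ (dig ∘ φ k)                          ≈⟨ assoc˘ ⟩
    (!₁ f ∘ dig) ∘ φ k                          ∎

  ⊗∘φ∘c : ∀ k {f : Hom (!₀ (𝒰^ k)) A} {g : Hom (!₀ (𝒰^ k)) B} →
          ((f ∘ φ k) ⊗₁ (g ∘ φ k)) ∘ c k ≈ (f ⊗₁ g) ∘ (contraction ∘ φ k)
  ⊗∘φ∘c k = trans (pullˡ (trans ⊗-merge (⊗-resp-≈ (cancelʳ (φ∘φ⁻¹ k)) (cancelʳ (φ∘φ⁻¹ k)))))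
                  (refl⟩∘⟨ assoc˘)

  Cur∘ : ∀ {f : Hom (!₀ (C & A)) B} {g : Hom X (!₀ C)} → Cur f ∘ g ≈ cur (f ∘ (m² ∘ (g ⊗₁ id)))
  Cur∘ = trans cur-natural (cur-cong assoc)

  lam-correct : ∀ {k} (t : Λ (suc k)) → CbN-Correct t → CbN-Correct (lam t)
  lam-correct {k} t ih = sym (begin
    (λₙ ∘! Cur ⟦ t ⟧ⁿ) ∘ φ k                    ≈⟨ der∘!₁-∘! ⟩∘⟨refl ⟩
    (λ𝒰 ∘ Cur ⟦ t ⟧ⁿ) ∘ φ k                     ≈⟨ pullʳ Cur∘ ⟩
    λ𝒰 ∘ cur (⟦ t ⟧ⁿ ∘ φ (suc k))               ≈⟨ λ𝒰∘ ⟩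
    fold𝒰 ∘ ⟨ 0m , cur (⟦ t ⟧ⁿ ∘ φ (suc k)) ⟩   ≈⟨ refl⟩∘⟨ ⟨⟩-cong refl (cur-cong ih) ⟨
    fold𝒰 ∘ ⟨ 0m , cur ⟦ cbn t ⟧ᵇ ⟩              ∎)

  app-correct : ∀ {k} (t s : Λ k) → CbN-Correct t → CbN-Correct s → CbN-Correct (app t s)
  app-correct {k} t s iht ihs = begin
    ev ∘ (((π₂ ∘ (unfold𝒰 ∘ ⟦ cbn t ⟧ᵇ)) ⊗₁ (π₁ ∘ (unfold𝒰 ∘ ⟦ bang (cbn s) ⟧ᵇ))) ∘ c k)
      ≈⟨ refl⟩∘⟨ ⊗-resp-≈ operator operand ⟩∘⟨refl ⟩
    ev ∘ ((((app𝒰 ∘ ⟦ t ⟧ⁿ) ∘ φ k) ⊗₁ ((!₁ ⟦ s ⟧ⁿ ∘ dig) ∘ φ k)) ∘ c k)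
      ≈⟨ refl⟩∘⟨ ⊗∘φ∘c k ⟩
    ev ∘ (((app𝒰 ∘ ⟦ t ⟧ⁿ) ⊗₁ (!₁ ⟦ s ⟧ⁿ ∘ dig)) ∘ (contraction ∘ φ k))
      ≈⟨ trans (refl⟩∘⟨ assoc˘) assoc˘ ⟩
    (ev ∘ (((app𝒰 ∘ ⟦ t ⟧ⁿ) ⊗₁ (!₁ ⟦ s ⟧ⁿ ∘ dig)) ∘ contraction)) ∘ φ k
      ≈⟨ Ev-∘! ⟩∘⟨refl ⟨
    (Ev ∘! ⟨ app𝒰 ∘ ⟦ t ⟧ⁿ , ⟦ s ⟧ⁿ ⟩) ∘ φ k
      ≈⟨ (refl⟩∘⟨ !-resp-≈ (⟨⟩-cong der∘!₁-∘! refl) ⟩∘⟨refl) ⟩∘⟨refl ⟨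
    (Ev ∘! ⟨ appₙ ∘! ⟦ t ⟧ⁿ , ⟦ s ⟧ⁿ ⟩) ∘ φ k
      ∎
    where
    operator : π₂ ∘ (unfold𝒰 ∘ ⟦ cbn t ⟧ᵇ) ≈ (app𝒰 ∘ ⟦ t ⟧ⁿ) ∘ φ k
    operator = trans assoc˘ (trans (refl⟩∘⟨ iht) assoc˘)

    operand : π₁ ∘ (unfold𝒰 ∘ ⟦ bang (cbn s) ⟧ᵇ) ≈ (!₁ ⟦ s ⟧ⁿ ∘ dig) ∘ φ k
    operand = begin
      π₁ ∘ (unfold𝒰 ∘ (fold𝒰 ∘ ⟨ !₁ ⟦ cbn s ⟧ᵇ ∘ p k , 0m ⟩))
        ≈⟨ trans (refl⟩∘⟨ cancelˡ unfold𝒰∘fold𝒰) project₁ ⟩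
      !₁ ⟦ cbn s ⟧ᵇ ∘ p k
        ≈⟨ !-resp-≈ ihs ⟩∘⟨refl ⟩
      !₁ (⟦ s ⟧ⁿ ∘ φ k) ∘ p k
        ≈⟨ !₁∘φ∘p k ⟩
      (!₁ ⟦ s ⟧ⁿ ∘ dig) ∘ φ k
        ∎

theorem15 : ∀ {o ℓ e} (M : LLModel o ℓ e) →
    (k : ℕ) (t : Λ k) → Interp.CbN-Correct M t
theorem15 M k (var v)   = CbN.⟦var⟧≈πᵏ∘φ M v
theorem15 M k (lam t)   = CbN.lam-correct M t (theorem15 M (suc k) t)
theorem15 M k (app t s) = CbN.app-correct M t s (theorem15 M k t) (theorem15 M k s)
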